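{- There is a randomized distributed algorithm that, using only $O(\log n)$ bits of shared randomness, solves the splitting problem in zero rounds with probability at least $1-1/n$.
   Context: Splitting problem: given a bipartite graph $H=(U,V,E)$ (on $O(n)$ nodes, $n$ known) in which every node of $U$ has at least $\Omega(\log^{c} n)$ neighbors in $V$, where $c\geq 1$ is a constant that can be chosen sufficiently large, color each node of $V$ red or blue so that each node of $U$ has at least one neighbor of each color. A zero-round algorithm means each node decides its output using only its own identifier and the available randomness, without communication. Shared randomness means a string of random bits known to all nodes (with no private randomness). -}

module Defs where

open import Data.Nat using (ℕ; zero; suc; _+_; _*_; _^_; _≤_; _<_)
open import Data.Nat.Logarithm using (⌊log₂_⌋; ⌈log₂_⌉)
open import Data.Bool using (Bool; true; false; _∧_; not; if_then_else_)
open import Data.Fin using (Fin)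
open import Data.Fin.Properties using ()
open import Data.List using (List; []; _∷_; map; _++_; length; filter)
import Data.List as L
open import Data.Bool.ListAction using (all; any)
open import Data.Vec using (Vec; []; _∷_)
open import Data.Sum using (_⊎_; [_,_])
open import Function.Definitions using (Injective)
open import Relation.Binary.PropositionalEquality using (_≡_)

-- A finite bipartite graph H = (U, V, E) with U = Fin p, V = Fin q,
-- given by its (decidable) adjacency relation.
record Bipartite : Set where
  field
    p q : ℕ
    adj : Fin p → Fin q → Bool
open Bipartite public

degree : (H : Bipartite) → Fin (p H) → ℕ
degree H u = length (filter (λ v → Data.Bool._≟_ (adj H u v) true) (L.allFin (q H)))
  where import Data.Bool

record IdAssignment (H : Bipartite) (N : ℕ) : Set where
  field
    ident     : Fin (p H) ⊎ Fin (q H) → ℕ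
    injective : Injective _≡_ _≡_ ident
    bounded   : ∀ x → ident x < N
open IdAssignment public

-- A red/blue colouring of V (true = red, false = blue) solves the
-- splitting problem iff every u ∈ U has a red and a blue neighbour.
splits : (H : Bipartite) → (Fin (q H) → Bool) → Bool
splits H col =
  all (λ u → any (λ v → adj H u v ∧ col v) (L.allFin (q H))
             ∧ any (λ v → adj H u v ∧ not (col v)) (L.allFin (q H)))
        (L.allFin (p H))

bitStrings : (k : ℕ) → List (Vec Bool k)
bitStrings zero    = [] ∷ []
bitStrings (suc k) = map (true ∷_) (bitStrings k) ++ map (false ∷_) (bitStrings k)

-- number of strings in the (uniform) sample space for which a predicate holds
countTrue : {k : ℕ} → (Vec Bool k → Bool) → ℕ
countTrue {k} P = length (filter (λ r → Data.Bool._≟_ (P r) true) (bitStrings k))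
  where import Data.Bool

-- A zero-round algorithm with shared randomness using k(n) bits:
-- each node of V computes its colour from n, the shared random string,
-- and its own identifier only.
ZeroRoundAlg : (ℕ → ℕ) → Set
ZeroRoundAlg k = (n : ℕ) → Vec Bool (k n) → ℕ → Bool

runAlg : ∀ {k} → ZeroRoundAlg k → (n : ℕ) → (H : Bipartite) → {N : ℕ} →
         IdAssignment H N → Vec Bool (k n) → Fin (q H) → Bool
runAlg A n H ids r v = A n r (ident ids (Data.Sum.inj₂ v))
  where import Data.Sum

module Submission where

-- Idea: derandomise a random colouring of the identifiers down to a fixed
-- family of 2^(C log n) colourings, so that the shared random string only has
-- to select a member.  A node u ∈ U inspects ℓ^3 of its neighbours (ℓ = ⌊log n⌋;
-- the degree hypothesis guarantees enough of them), and u fails only when the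
-- selected colouring is monochromatic on their identifiers.  A uniformly random
-- colouring is monochromatic on a fixed set of e+1 identifiers with
-- probability ≤ 2^-e, so among M independent ones at least t are with
-- probability ≤ M^t 2^(-e t); a union bound over all n^(d(e+1)) candidate sets
-- shows that some family has fewer than t = d L + 2 monochromatic members on
-- every set.  With that family, each u fails for at most d L + 1 of the 2^K
-- random strings, and a union bound over U gives failure probability ≤ 1/n.

open import Defs
open import Data.Nat using (ℕ; zero; suc; _+_; _*_; _^_; _∸_; _≤_; _<_; z≤n; s≤s; _≤?_; _<?_; NonZero; >-nonZero; _⊓_; ⌊_/2⌋; ⌈_/2⌉)
open import Data.Nat.Properties
open import Data.Nat.Logarithm using (⌊log₂_⌋; ⌈log₂_⌉; ⌊log₂⌋-mono-≤; ⌈log₂⌉-mono-≤; ⌊log₂[2^n]⌋≡n; ⌈log₂2^n⌉≡n)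
open import Data.Nat.Logarithm.Core using (⌊log2⌋; ⌈log2⌉)
open import Data.Nat.Induction using (<-wellFounded)
open import Induction.WellFounded using (Acc; acc)
open import Data.Bool using (Bool; true; false; _∧_; _∨_; not; if_then_else_)
open import Data.Bool.ListAction using (all; any)
import Data.Bool as Bool
import Data.Bool.Properties as BoolProp
open import Data.Sum using (inj₂)
open import Data.Sum.Properties using (inj₂-injective)
open import Data.List using (List; []; _∷_; _++_; map; concatMap; length; filter; take; upTo; allFin)
import Data.List.Properties as List
open import Data.List.Relation.Unary.All using (All; []; _∷_)
import Data.List.Relation.Unary.All as All
import Data.List.Relation.Unary.All.Properties as AllProp
open import Data.List.Relation.Unary.Unique.Propositional using (Unique; []; _∷_)
import Data.List.Relation.Unary.Unique.Propositional.Properties as Unique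
open import Data.List.Membership.Propositional using (_∈_)
open import Data.List.Relation.Unary.Any using (here; there)
import Data.List.Relation.Unary.Any as Any
import Data.List.Membership.Propositional.Properties as ∈
open import Data.Vec using (Vec; []; _∷_; toList; replicate)
import Data.Vec as Vec
import Data.Vec.Properties as VecProp
open import Data.Fin using (Fin)
open import Data.Product using (Σ; ∃; _,_; proj₁; proj₂)
open import Relation.Binary.PropositionalEquality
open import Relation.Nullary using (yes; no; contradiction)
open import Function using (_∘_)
open import Data.Nat.Solver using (module +-*-Solver)
open +-*-Solver using (solve; _:=_; _:+_; _:*_; con)
open import Algebra.Properties.CommutativeSemigroup +-commutativeSemigroup
  using () renaming (interchange to +-interchange)
open import Algebra.Properties.CommutativeSemigroup *-commutativeSemigroup
  using () renaming (x∙yz≈y∙xz to *-left-swap)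

𝟙 : Bool → ℕ
𝟙 true  = 1
𝟙 false = 0

-- Finite sums over a list, and the number of entries satisfying a test
-- (for a uniformly distributed list entry: the probability times the length).
sumOver : {A : Set} → List A → (A → ℕ) → ℕ
sumOver []       f = 0
sumOver (x ∷ xs) f = f x + sumOver xs f

count : {A : Set} → (A → Bool) → List A → ℕ
count P xs = sumOver xs (λ x → 𝟙 (P x))

module _ {A : Set} where

  sumOver-mono : (xs : List A) {f g : A → ℕ} → (∀ x → f x ≤ g x) → sumOver xs f ≤ sumOver xs g
  sumOver-mono []       h = z≤n
  sumOver-mono (x ∷ xs) h = +-mono-≤ (h x) (sumOver-mono xs h)

  sumOver-cong : (xs : List A) {f g : A → ℕ} → (∀ x → f x ≡ g x) → sumOver xs f ≡ sumOver xs g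
  sumOver-cong []       h = refl
  sumOver-cong (x ∷ xs) h = cong₂ _+_ (h x) (sumOver-cong xs h)

  sumOver-const : (xs : List A) (c : ℕ) → sumOver xs (λ _ → c) ≡ length xs * c
  sumOver-const []       c = refl
  sumOver-const (x ∷ xs) c = cong (c +_) (sumOver-const xs c)

  sumOver-+ : (xs : List A) (f g : A → ℕ) → sumOver xs (λ x → f x + g x) ≡ sumOver xs f + sumOver xs g
  sumOver-+ []       f g = refl
  sumOver-+ (x ∷ xs) f g =
    trans (cong (f x + g x +_) (sumOver-+ xs f g)) (+-interchange (f x) (g x) _ _)

  sumOver-*ʳ : (xs : List A) (f : A → ℕ) (c : ℕ) → sumOver xs (λ x → f x * c) ≡ sumOver xs f * c
  sumOver-*ʳ []       f c = refl
  sumOver-*ʳ (x ∷ xs) f c = trans (cong (f x * c +_) (sumOver-*ʳ xs f c)) (sym (*-distribʳ-+ c (f x) _))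

  sumOver-++ : (xs ys : List A) (f : A → ℕ) → sumOver (xs ++ ys) f ≡ sumOver xs f + sumOver ys f
  sumOver-++ []       ys f = refl
  sumOver-++ (x ∷ xs) ys f = trans (cong (f x +_) (sumOver-++ xs ys f)) (sym (+-assoc (f x) _ _))

module _ {A B : Set} where

  sumOver-map : (g : A → B) (xs : List A) (f : B → ℕ) → sumOver (map g xs) f ≡ sumOver xs (λ x → f (g x))
  sumOver-map g []       f = refl
  sumOver-map g (x ∷ xs) f = cong (f (g x) +_) (sumOver-map g xs f)

  sumOver-concatMap : (g : A → List B) (xs : List A) (f : B → ℕ) →
    sumOver (concatMap g xs) f ≡ sumOver xs (λ x → sumOver (g x) f)
  sumOver-concatMap g []       f = refl
  sumOver-concatMap g (x ∷ xs) f =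
    trans (sumOver-++ (g x) (concatMap g xs) f) (cong (sumOver (g x) f +_) (sumOver-concatMap g xs f))

  length-concatMap : (g : A → List B) (xs : List A) → length (concatMap g xs) ≡ sumOver xs (λ x → length (g x))
  length-concatMap g []       = refl
  length-concatMap g (x ∷ xs) =
    trans (List.length-++ (g x)) (cong (length (g x) +_) (length-concatMap g xs))

module _ {A : Set} where

  count-≤-length : (P : A → Bool) (xs : List A) → count P xs ≤ length xs
  count-≤-length P xs = begin
    count P xs               ≤⟨ sumOver-mono xs (λ x → 𝟙≤1 (P x)) ⟩
    sumOver xs (λ _ → 1)     ≡⟨ sumOver-const xs 1 ⟩
    length xs * 1            ≡⟨ *-identityʳ (length xs) ⟩
    length xs                ∎
    where
    open ≤-Reasoning
    𝟙≤1 : ∀ b → 𝟙 b ≤ 1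
    𝟙≤1 true  = ≤-refl
    𝟙≤1 false = z≤n

  count-mono : {P Q : A → Bool} → (∀ x → P x ≡ true → Q x ≡ true) → (xs : List A) → count P xs ≤ count Q xs
  count-mono {P} {Q} P⇒Q xs = sumOver-mono xs 𝟙-mono
    where
    𝟙-mono : ∀ x → 𝟙 (P x) ≤ 𝟙 (Q x)
    𝟙-mono x with P x in eq
    ... | true  rewrite P⇒Q x eq = ≤-refl
    ... | false = z≤n

  count-∨ : (P Q : A → Bool) (xs : List A) → count (λ x → P x ∨ Q x) xs ≤ count P xs + count Q xs
  count-∨ P Q xs = ≤-trans (sumOver-mono xs (λ x → 𝟙-∨ (P x) (Q x))) (≤-reflexive (sumOver-+ xs _ _))
    where
    𝟙-∨ : ∀ a b → 𝟙 (a ∨ b) ≤ 𝟙 a + 𝟙 b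
    𝟙-∨ true  b = s≤s z≤n
    𝟙-∨ false b = ≤-refl

  count-never : (xs : List A) → count (λ _ → false) xs ≡ 0
  count-never xs = trans (sumOver-const xs 0) (*-zeroʳ (length xs))

  sumOver-if : (P : A → Bool) (xs : List A) (a b : ℕ) →
    sumOver xs (λ x → if P x then a else b) ≤ length xs * b + count P xs * a
  sumOver-if P xs a b = begin
    sumOver xs (λ x → if P x then a else b)             ≤⟨ sumOver-mono xs (λ x → split (P x)) ⟩
    sumOver xs (λ x → b + 𝟙 (P x) * a)                  ≡⟨ sumOver-+ xs _ _ ⟩
    sumOver xs (λ _ → b) + sumOver xs (λ x → 𝟙 (P x) * a) ≡⟨ cong₂ _+_ (sumOver-const xs b) (sumOver-*ʳ xs _ a) ⟩
    length xs * b + count P xs * a                      ∎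
    where
    open ≤-Reasoning
    split : ∀ c → (if c then a else b) ≤ b + 𝟙 c * a
    split true  = ≤-trans (≤-reflexive (sym (+-identityʳ a))) (m≤n+m (a + 0) b)
    split false = m≤m+n b 0

  count<length⇒failure : (P : A → Bool) (xs : List A) → count P xs < length xs → Σ A (λ x → P x ≡ false)
  count<length⇒failure P (x ∷ xs) lt with P x in eq
  ... | false = x , eq
  ... | true  = count<length⇒failure P xs (≤-pred lt)

  countTrue-count : (P : A → Bool) (xs : List A) →
    length (filter (λ r → P r Bool.≟ true) xs) ≡ count P xs
  countTrue-count P []       = refl
  countTrue-count P (x ∷ xs) with P x
  ... | true  = cong suc (countTrue-count P xs)
  ... | false = countTrue-count P xs

count-any : {A J : Set} (js : List J) (P : J → A → Bool) (xs : List A) →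
  count (λ x → any (λ j → P j x) js) xs ≤ sumOver js (λ j → count (P j) xs)
count-any []       P xs = ≤-reflexive (count-never xs)
count-any (j ∷ js) P xs =
  ≤-trans (count-∨ (P j) _ xs) (+-monoʳ-≤ (count (P j) xs) (count-any js P xs))

any-false : {A : Set} (P : A → Bool) (xs : List A) → any P xs ≡ false → {x : A} → x ∈ xs → P x ≡ false
any-false P (x ∷ xs) h (here refl) with P x
... | false = refl
any-false P (x ∷ xs) h (there x∈) with P x
... | false = any-false P xs h x∈

not-all⇒any : {A : Set} (P Q : A → Bool) → (∀ x → P x ≡ false → Q x ≡ true) →
  (xs : List A) → not (all P xs) ≡ true → any Q xs ≡ true
not-all⇒any P Q fail⇒Q (x ∷ xs) h with P x in eq
... | false rewrite fail⇒Q x eq = refl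
... | true with Q x
...   | true  = refl
...   | false = not-all⇒any P Q fail⇒Q xs h

length-bitStrings : (k : ℕ) → length (bitStrings k) ≡ 2 ^ k
length-bitStrings zero    = refl
length-bitStrings (suc k) = begin
  length (map (true ∷_) bs ++ map (false ∷_) bs)      ≡⟨ List.length-++ (map (true ∷_) bs) ⟩
  length (map (true ∷_) bs) + length (map (false ∷_) bs) ≡⟨ cong₂ _+_ (List.length-map _ bs) (List.length-map _ bs) ⟩
  length bs + length bs                                ≡⟨ cong (λ m → m + m) (length-bitStrings k) ⟩
  2 ^ k + 2 ^ k                                        ≡⟨ cong (2 ^ k +_) (+-identityʳ (2 ^ k)) ⟨
  2 ^ suc k                                            ∎
  where
  open ≡-Reasoning
  bs : List (Vec Bool k)
  bs = bitStrings k

count-bitStrings-suc : (k : ℕ) (P : Vec Bool (suc k) → Bool) →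
  count P (bitStrings (suc k)) ≡ count (λ f → P (true ∷ f)) (bitStrings k) + count (λ f → P (false ∷ f)) (bitStrings k)
count-bitStrings-suc k P =
  trans (sumOver-++ (map (true ∷_) (bitStrings k)) _ _)
        (cong₂ _+_ (sumOver-map (true ∷_) (bitStrings k) _) (sumOver-map (false ∷_) (bitStrings k) _))

-- All length-k sequences with entries from a list xs, for a sequence type B
-- given by its empty sequence and its cons operation (vectors, or plain lists).
module Sequences {A : Set} (B : ℕ → Set) (nil : B 0) (cons : ∀ {k} → A → B k → B (suc k)) where

  sequences : List A → (k : ℕ) → List (B k)
  sequences xs zero    = nil ∷ []
  sequences xs (suc k) = concatMap (λ x → map (cons x) (sequences xs k)) xs

  length-sequences : (xs : List A) (k : ℕ) → length (sequences xs k) ≡ length xs ^ k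
  length-sequences xs zero    = refl
  length-sequences xs (suc k) = begin
    length (concatMap (λ x → map (cons x) ys) xs)  ≡⟨ length-concatMap _ xs ⟩
    sumOver xs (λ x → length (map (cons x) ys))    ≡⟨ sumOver-cong xs (λ x → List.length-map (cons x) ys) ⟩
    sumOver xs (λ _ → length ys)                   ≡⟨ sumOver-const xs (length ys) ⟩
    length xs * length ys                          ≡⟨ cong (length xs *_) (length-sequences xs k) ⟩
    length xs * length xs ^ k                      ∎
    where
    open ≡-Reasoning
    ys : List (B k)
    ys = sequences xs k

module Vectors {A : Set} = Sequences {A} (Vec A) [] _∷_
  renaming (sequences to vectorsOver; length-sequences to length-vectorsOver)
module Lists {A : Set} = Sequences {A} (λ _ → List A) [] _∷_
  renaming (sequences to listsOver; length-sequences to length-listsOver)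
open Vectors
open Lists

∈-listsOver : {A : Set} {xs : List A} (S : List A) → All (_∈ xs) S → S ∈ listsOver xs (length S)
∈-listsOver []      []         = here refl
∈-listsOver (x ∷ S) (x∈ ∷ S⊆) =
  ∈.∈-concatMap⁺ (λ y → map (y ∷_) (listsOver _ (length S)))
                 (Any.map (λ { refl → ∈.∈-map⁺ (x ∷_) (∈-listsOver S S⊆) }) x∈)

-- Boolean vectors indexed by identifiers serve both as colourings of the
-- identifiers 0 … N-1 (true = red) and as masks selecting a set of them.
-- entry v x is the entry at identifier x (false when x is out of range).
entry : {N : ℕ} → Vec Bool N → ℕ → Bool
entry []      x       = false
entry (c ∷ v) zero    = c
entry (c ∷ v) (suc x) = entry v x

weight : {N : ℕ} → Vec Bool N → ℕ
weight []      = 0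
weight (b ∷ m) = 𝟙 b + weight m

_==_ : Bool → Bool → Bool
true  == b = b
false == b = not b

agrees : {N : ℕ} → Bool → Vec Bool N → Vec Bool N → Bool
agrees b []      []          = true
agrees b (c ∷ f) (false ∷ m) = agrees b f m
agrees b (c ∷ f) (true ∷ m)  = (c == b) ∧ agrees b f m

monochrome : {N : ℕ} → Vec Bool N → Vec Bool N → Bool
monochrome m f = agrees true f m ∨ agrees false f m

count-first-agrees : {A : Set} (b : Bool) (P : A → Bool) (xs : List A) →
  count (λ x → (true == b) ∧ P x) xs + count (λ x → (false == b) ∧ P x) xs ≡ count P xs
count-first-agrees true  P xs = trans (cong (count P xs +_) (count-never xs)) (+-identityʳ _)
count-first-agrees false P xs = cong (_+ count P xs) (count-never xs)

agrees-count : {N : ℕ} (b : Bool) (m : Vec Bool N) →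
  count (λ f → agrees b f m) (bitStrings N) * 2 ^ weight m ≤ 2 ^ N
agrees-count b [] = ≤-refl
agrees-count {suc N} b (false ∷ m) = begin
  count (λ f → agrees b f (false ∷ m)) (bitStrings (suc N)) * 2 ^ w ≡⟨ cong (_* 2 ^ w) (count-bitStrings-suc N _) ⟩
  (X + X) * 2 ^ w                                                 ≡⟨ *-distribʳ-+ (2 ^ w) X X ⟩
  X * 2 ^ w + X * 2 ^ w                                           ≤⟨ +-mono-≤ (agrees-count b m) (agrees-count b m) ⟩
  2 ^ N + 2 ^ N                                                   ≡⟨ cong (2 ^ N +_) (+-identityʳ (2 ^ N)) ⟨
  2 ^ suc N                                                       ∎
  where
  open ≤-Reasoning
  w : ℕ
  w = weight m
  X : ℕ
  X = count (λ f → agrees b f m) (bitStrings N)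
agrees-count {suc N} b (true ∷ m) = begin
  count (λ f → agrees b f (true ∷ m)) (bitStrings (suc N)) * 2 ^ suc w
    ≡⟨ cong (_* 2 ^ suc w) (trans (count-bitStrings-suc N _) (count-first-agrees b _ (bitStrings N))) ⟩
  X * (2 * 2 ^ w)   ≡⟨ *-left-swap X 2 (2 ^ w) ⟩
  2 * (X * 2 ^ w)   ≤⟨ *-monoʳ-≤ 2 (agrees-count b m) ⟩
  2 * 2 ^ N         ∎
  where
  open ≤-Reasoning
  w : ℕ
  w = weight m
  X : ℕ
  X = count (λ f → agrees b f m) (bitStrings N)

monochrome-count : {N : ℕ} (m : Vec Bool N) (e : ℕ) → e < weight m →
  count (monochrome m) (bitStrings N) * 2 ^ e ≤ 2 ^ N
monochrome-count {N} m e e<w = *-cancelˡ-≤ 2 (begin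
  2 * (Y * 2 ^ e)                  ≡⟨ *-left-swap 2 Y (2 ^ e) ⟩
  Y * 2 ^ suc e                    ≤⟨ *-monoʳ-≤ Y (^-monoʳ-≤ 2 e<w) ⟩
  Y * 2 ^ w                        ≤⟨ *-monoˡ-≤ (2 ^ w) (count-∨ (λ f → agrees true f m) (λ f → agrees false f m) bs) ⟩
  (Xᵣ + Xᵦ) * 2 ^ w                ≡⟨ *-distribʳ-+ (2 ^ w) Xᵣ Xᵦ ⟩
  Xᵣ * 2 ^ w + Xᵦ * 2 ^ w          ≤⟨ +-mono-≤ (agrees-count true m) (agrees-count false m) ⟩
  2 ^ N + 2 ^ N                    ≡⟨ cong (2 ^ N +_) (+-identityʳ (2 ^ N)) ⟨
  2 * 2 ^ N                        ∎)
  where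
  open ≤-Reasoning
  bs : List (Vec Bool N)
  bs = bitStrings N
  w Y Xᵣ Xᵦ : ℕ
  w  = weight m
  Y  = count (monochrome m) bs
  Xᵣ = count (λ f → agrees true f m) bs
  Xᵦ = count (λ f → agrees false f m) bs

insert : {N : ℕ} → ℕ → Vec Bool N → Vec Bool N
insert x       []      = []
insert zero    (_ ∷ m) = true ∷ m
insert (suc x) (b ∷ m) = b ∷ insert x m

maskOf : {N : ℕ} → List ℕ → Vec Bool N
maskOf []      = replicate _ false
maskOf (x ∷ S) = insert x (maskOf S)

entry-insert : {N : ℕ} (m : Vec Bool N) {x y : ℕ} → x ≢ y → entry (insert y m) x ≡ entry m x
entry-insert []      x≢y = refl
entry-insert (b ∷ m) {zero}  {zero}  x≢y = contradiction refl x≢y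
entry-insert (b ∷ m) {zero}  {suc y} x≢y = refl
entry-insert (b ∷ m) {suc x} {zero}  x≢y = refl
entry-insert (b ∷ m) {suc x} {suc y} x≢y = entry-insert m (x≢y ∘ cong suc)

entry-empty : (N x : ℕ) → entry (replicate N false) x ≡ false
entry-empty zero    x       = refl
entry-empty (suc N) zero    = refl
entry-empty (suc N) (suc x) = entry-empty N x

entry-maskOf : {N : ℕ} {x : ℕ} (S : List ℕ) → All (x ≢_) S → entry (maskOf {N} S) x ≡ false
entry-maskOf {N} {x} []      []             = entry-empty N x
entry-maskOf         (y ∷ S) (x≢y ∷ x∉S)   = trans (entry-insert (maskOf S) x≢y) (entry-maskOf S x∉S)

weight-insert : {N : ℕ} (m : Vec Bool N) {x : ℕ} → x < N → entry m x ≡ false →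
  weight (insert x m) ≡ suc (weight m)
weight-insert (b ∷ m) {zero}  x<N refl    = refl
weight-insert (b ∷ m) {suc x} x<N notSel =
  trans (cong (𝟙 b +_) (weight-insert m (≤-pred x<N) notSel)) (+-suc (𝟙 b) (weight m))

weight-empty : (N : ℕ) → weight (replicate N false) ≡ 0
weight-empty zero    = refl
weight-empty (suc N) = weight-empty N

weight-maskOf : {N : ℕ} (S : List ℕ) → Unique S → All (_< N) S → weight (maskOf {N} S) ≡ length S
weight-maskOf {N} []      []            []           = weight-empty N
weight-maskOf     (x ∷ S) (x∉S ∷ uniq)  (x<N ∷ S<N) =
  trans (weight-insert (maskOf S) x<N (entry-maskOf S x∉S)) (cong suc (weight-maskOf S uniq S<N))

==-refl : (b : Bool) → (b == b) ≡ true
==-refl true  = refl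
==-refl false = refl

agrees-insert : {N : ℕ} (b : Bool) (f m : Vec Bool N) {x : ℕ} →
  entry f x ≡ b → agrees b f m ≡ true → agrees b f (insert x m) ≡ true
agrees-insert b []      []          fx≡b ag = refl
agrees-insert b (c ∷ f) (true ∷ m)  {zero}  refl ag = ag
agrees-insert b (c ∷ f) (false ∷ m) {zero}  refl ag rewrite ==-refl c = ag
agrees-insert b (c ∷ f) (false ∷ m) {suc x} fx≡b ag = agrees-insert b f m fx≡b ag
agrees-insert b (c ∷ f) (true ∷ m)  {suc x} fx≡b ag with c == b
... | true = agrees-insert b f m fx≡b ag

agrees-empty : {N : ℕ} (b : Bool) (f : Vec Bool N) → agrees b f (replicate N false) ≡ true
agrees-empty b []      = refl
agrees-empty b (c ∷ f) = agrees-empty b f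

agrees-maskOf : {N : ℕ} (b : Bool) (f : Vec Bool N) (S : List ℕ) →
  All (λ x → entry f x ≡ b) S → agrees b f (maskOf S) ≡ true
agrees-maskOf b f []      []             = agrees-empty b f
agrees-maskOf b f (x ∷ S) (fx≡b ∷ S≡b)  = agrees-insert b f (maskOf S) fx≡b (agrees-maskOf b f S S≡b)

-- atLeast t x decides t ≤ x; it is defined by recursion on both arguments
-- so that atLeast (1+t) (1+x) reduces to atLeast t x.
atLeast : ℕ → ℕ → Bool
atLeast zero    x       = true
atLeast (suc t) zero    = false
atLeast (suc t) (suc x) = atLeast t x

atLeast-sound : (t x : ℕ) → atLeast t x ≡ true → t ≤ x
atLeast-sound zero    x       _ = z≤n
atLeast-sound (suc t) (suc x) h = s≤s (atLeast-sound t x h)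

atLeast-complete : {t x : ℕ} → t ≤ x → atLeast t x ≡ true
atLeast-complete z≤n       = refl
atLeast-complete (s≤s t≤x) = atLeast-complete t≤x

atLeast-false : (t x : ℕ) → atLeast t x ≡ false → x < t
atLeast-false (suc t) zero    _ = s≤s z≤n
atLeast-false (suc t) (suc x) h = s≤s (atLeast-false t x h)

-- If an event P has probability at
-- most 1/E in a sample space Ω, then among k independent samples it occurs
-- at least t times with probability at most k^t / E^t.
module Repetition {A : Set} (Ω : List A) (P : A → Bool) (E : ℕ) (rare : count P Ω * E ≤ length Ω) where

  W c : ℕ
  W = length Ω
  c = count P Ω

  hits : {k : ℕ} → Vec A k → ℕ
  hits F = count P (toList F)

  manyHits : ℕ → ℕ → ℕ
  manyHits k t = count (λ F → atLeast t (hits F)) (vectorsOver Ω k)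

  -- Splitting off the first sample: it either is an occurrence or it is not.
  manyHits-step : (k t : ℕ) → manyHits (suc k) (suc t) ≤ W * manyHits k (suc t) + c * manyHits k t
  manyHits-step k t = begin
    manyHits (suc k) (suc t)
      ≡⟨ sumOver-concatMap (λ f → map (f ∷_) (vectorsOver Ω k)) Ω _ ⟩
    sumOver Ω (λ f → count (λ F → atLeast (suc t) (hits F)) (map (f ∷_) (vectorsOver Ω k)))
      ≡⟨ sumOver-cong Ω (λ f → trans (sumOver-map (f ∷_) (vectorsOver Ω k) _) (byFirst f)) ⟩
    sumOver Ω (λ f → if P f then manyHits k t else manyHits k (suc t))
      ≤⟨ sumOver-if P Ω _ _ ⟩
    W * manyHits k (suc t) + c * manyHits k t ∎
    where
    open ≤-Reasoning
    byFirst : ∀ f → count (λ F → atLeast (suc t) (hits (f ∷ F))) (vectorsOver Ω k)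
                  ≡ (if P f then manyHits k t else manyHits k (suc t))
    byFirst f with P f
    ... | true  = refl
    ... | false = refl

  manyHits-bound : (k t : ℕ) → manyHits k t * E ^ t ≤ W ^ k * k ^ t
  manyHits-bound zero    zero    = ≤-refl
  manyHits-bound zero    (suc t) = z≤n
  manyHits-bound (suc k) zero    = begin
    manyHits (suc k) 0 * 1   ≡⟨ *-identityʳ _ ⟩
    manyHits (suc k) 0       ≤⟨ count-≤-length _ (vectorsOver Ω (suc k)) ⟩
    length (vectorsOver Ω (suc k)) ≡⟨ length-vectorsOver Ω (suc k) ⟩
    W ^ suc k                ≡⟨ *-identityʳ _ ⟨
    W ^ suc k * 1            ∎
    where open ≤-Reasoning
  manyHits-bound (suc k) (suc t) = begin
    manyHits (suc k) (suc t) * (E * E ^ t)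
      ≤⟨ *-monoˡ-≤ (E * E ^ t) (manyHits-step k t) ⟩
    (W * G₁ + c * G₀) * (E * E ^ t)
      ≡⟨ regroup W G₁ c G₀ E (E ^ t) ⟩
    W * (G₁ * (E * E ^ t)) + (c * E) * (G₀ * E ^ t)
      ≤⟨ +-mono-≤ (*-monoʳ-≤ W (manyHits-bound k (suc t))) (*-mono-≤ rare (manyHits-bound k t)) ⟩
    W * (W ^ k * k ^ suc t) + W * (W ^ k * k ^ t)
      ≡⟨ collect W (W ^ k) (k ^ t) k ⟩
    W ^ suc k * (suc k * k ^ t)
      ≤⟨ *-monoʳ-≤ (W ^ suc k) (*-monoʳ-≤ (suc k) (^-monoˡ-≤ t (n≤1+n k))) ⟩
    W ^ suc k * suc k ^ suc t ∎
    where
    open ≤-Reasoning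
    G₁ G₀ : ℕ
    G₁ = manyHits k (suc t)
    G₀ = manyHits k t
    regroup : ∀ W A c B E Eₜ → (W * A + c * B) * (E * Eₜ) ≡ W * (A * (E * Eₜ)) + (c * E) * (B * Eₜ)
    regroup = solve 6 (λ W A c B E Eₜ → (W :* A :+ c :* B) :* (E :* Eₜ) := W :* (A :* (E :* Eₜ)) :+ (c :* E) :* (B :* Eₜ)) refl
    collect : ∀ W Wₖ kₜ k → W * (Wₖ * (k * kₜ)) + W * (Wₖ * kₜ) ≡ W * Wₖ * ((1 + k) * kₜ)
    collect = solve 4 (λ W Wₖ kₜ k → W :* (Wₖ :* (k :* kₜ)) :+ W :* (Wₖ :* kₜ) := W :* Wₖ :* ((con 1 :+ k) :* kₜ)) refl

-- A family of M colourings of the identifiers 0 … N-1 in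
-- which every set of e+1 distinct identifiers is monochromatic in fewer than
-- t members exists as soon as N^(e+1) · M^t < (2^e)^t: by the union bound over
-- the N^(e+1) candidate sets and the repetition bound, fewer than all
-- families are bad.
module GoodFamily (N M e t : ℕ) where

  Family : Set
  Family = Vec (Vec Bool N) M

  families : List Family
  families = vectorsOver (bitStrings N) M

  monoCount : List ℕ → Family → ℕ
  monoCount S F = count (monochrome (maskOf S)) (toList F)

  badFor : List ℕ → Family → Bool
  badFor S F = atLeast (suc e) (weight (maskOf {N} S)) ∧ atLeast t (monoCount S F)

  bad : Family → Bool
  bad F = any (λ S → badFor S F) (listsOver (upTo N) (suc e))

  badFor-count : (S : List ℕ) → count (badFor S) families * (2 ^ e) ^ t ≤ (2 ^ N) ^ M * M ^ t
  badFor-count S with atLeast (suc e) (weight (maskOf {N} S)) in large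
  ... | false = ≤-trans (≤-reflexive (cong (_* (2 ^ e) ^ t) (count-never families))) z≤n
  ... | true  = subst (λ W → manyHits M t * (2 ^ e) ^ t ≤ W ^ M * M ^ t)
                      (length-bitStrings N) (manyHits-bound M t)
    where
    rare : count (monochrome (maskOf S)) (bitStrings N) * 2 ^ e ≤ length (bitStrings N)
    rare = subst (count (monochrome (maskOf S)) (bitStrings N) * 2 ^ e ≤_) (sym (length-bitStrings N))
                 (monochrome-count (maskOf S) e (atLeast-sound (suc e) _ large))
    open Repetition (bitStrings N) (monochrome (maskOf S)) (2 ^ e) rare

  bad-count : count bad families * (2 ^ e) ^ t ≤ N ^ suc e * ((2 ^ N) ^ M * M ^ t)
  bad-count = begin
    count bad families * (2 ^ e) ^ t
      ≤⟨ *-monoˡ-≤ _ (count-any candidates badFor families) ⟩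
    sumOver candidates (λ S → count (badFor S) families) * (2 ^ e) ^ t
      ≡⟨ sumOver-*ʳ candidates _ _ ⟨
    sumOver candidates (λ S → count (badFor S) families * (2 ^ e) ^ t)
      ≤⟨ sumOver-mono candidates badFor-count ⟩
    sumOver candidates (λ _ → (2 ^ N) ^ M * M ^ t)
      ≡⟨ sumOver-const candidates _ ⟩
    length candidates * ((2 ^ N) ^ M * M ^ t)
      ≡⟨ cong (_* ((2 ^ N) ^ M * M ^ t)) (trans (length-listsOver (upTo N) (suc e)) (cong (_^ suc e) (List.length-upTo N))) ⟩
    N ^ suc e * ((2 ^ N) ^ M * M ^ t) ∎
    where
    open ≤-Reasoning
    candidates : List (List ℕ)
    candidates = listsOver (upTo N) (suc e)

  good-family : N ^ suc e * M ^ t < (2 ^ e) ^ t → Σ Family (λ F → bad F ≡ false)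
  good-family small = count<length⇒failure bad families
    (subst (count bad families <_) (sym (length-vectorsOver (bitStrings N) M))
      (subst (λ W → count bad families < W ^ M) (sym (length-bitStrings N)) fewer))
    where
    Z : ℕ
    Z = (2 ^ N) ^ M
    instance
      Z≢0 : NonZero Z
      Z≢0 = m^n≢0 (2 ^ N) M {{m^n≢0 2 N}}
    fewer : count bad families < Z
    fewer = *-cancelʳ-< ((2 ^ e) ^ t) _ _ (begin-strict
      count bad families * (2 ^ e) ^ t ≤⟨ bad-count ⟩
      N ^ suc e * (Z * M ^ t)           ≡⟨ *-left-swap (N ^ suc e) Z (M ^ t) ⟩
      Z * (N ^ suc e * M ^ t)           <⟨ *-monoʳ-< Z small ⟩
      Z * (2 ^ e) ^ t                   ∎)
      where open ≤-Reasoning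

  good-family-sound : (F : Family) → bad F ≡ false → (S : List ℕ) → length S ≡ suc e →
    Unique S → All (_< N) S → monoCount S F < t
  good-family-sound F notBad S len distinct inRange =
    atLeast-false t (monoCount S F) (fewHits (any-false _ _ notBad S∈))
    where
    S∈ : S ∈ listsOver (upTo N) (suc e)
    S∈ = subst (λ k → S ∈ listsOver (upTo N) k) len (∈-listsOver S (All.map ∈.∈-upTo⁺ inRange))
    large : atLeast (suc e) (weight (maskOf {N} S)) ≡ true
    large = atLeast-complete (≤-reflexive (sym (trans (weight-maskOf S distinct inRange) len)))
    fewHits : badFor S F ≡ false → atLeast t (monoCount S F) ≡ false
    fewHits h rewrite large = h

-- pow2 K is 2^K written as a sum, so that a vector of length pow2 (K+1)
-- splits into two halves of length pow2 K.
pow2 : ℕ → ℕ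
pow2 zero    = 1
pow2 (suc K) = pow2 K + pow2 K

pow2≡2^ : (K : ℕ) → pow2 K ≡ 2 ^ K
pow2≡2^ zero    = refl
pow2≡2^ (suc K) = trans (cong (λ m → m + m) (pow2≡2^ K)) (cong (2 ^ K +_) (sym (+-identityʳ (2 ^ K))))

select : {A : Set} (K : ℕ) → Vec Bool K → Vec A (pow2 K) → A
select zero    []          (x ∷ []) = x
select (suc K) (true ∷ r)  v        = select K r (Vec.take (pow2 K) v)
select (suc K) (false ∷ r) v        = select K r (Vec.drop (pow2 K) v)

count-select : {A : Set} (K : ℕ) (P : A → Bool) (v : Vec A (pow2 K)) →
  count (λ r → P (select K r v)) (bitStrings K) ≡ count P (toList v)
count-select zero    P (x ∷ []) = refl
count-select {A} (suc K) P v = begin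
  count (λ r → P (select (suc K) r v)) (bitStrings (suc K))
    ≡⟨ count-bitStrings-suc K _ ⟩
  count (λ r → P (select K r front)) (bitStrings K) + count (λ r → P (select K r back)) (bitStrings K)
    ≡⟨ cong₂ _+_ (count-select K P front) (count-select K P back) ⟩
  count P (toList front) + count P (toList back)
    ≡⟨ sumOver-++ (toList front) (toList back) _ ⟨
  count P (toList front ++ toList back)
    ≡⟨ cong (count P) (VecProp.toList-++ front back) ⟨
  count P (toList (front Vec.++ back))
    ≡⟨ cong (count P ∘ toList) (VecProp.take++drop≡id (pow2 K) v) ⟩
  count P (toList v) ∎
  where
  open ≡-Reasoning
  front back : Vec A (pow2 K)
  front = Vec.take (pow2 K) v
  back  = Vec.drop (pow2 K) v

familyColour : {N : ℕ} (K : ℕ) → Vec (Vec Bool N) (pow2 K) → Vec Bool K → ℕ → Bool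
familyColour K F r x = entry (select K r F) x

module ZeroRound (H : Bipartite) {N′ : ℕ} (ids : IdAssignment H N′) where

  idOf : Fin (q H) → ℕ
  idOf v = ident ids (inj₂ v)

  induced : {N : ℕ} → Vec Bool N → Fin (q H) → Bool
  induced f v = entry f (idOf v)

  idMask : {N : ℕ} → List (Fin (q H)) → Vec Bool N
  idMask T = maskOf (map idOf T)

  absent : (u : Fin (p H)) (g : Fin (q H) → Bool) → any (λ v → adj H u v ∧ g v) (allFin (q H)) ≡ false →
    (T : List (Fin (q H))) → All (λ v → adj H u v ≡ true) T → All (λ v → g v ≡ false) T
  absent u g none T = All.map λ {v} adjacent →
    subst (λ a → a ∧ g v ≡ false) adjacent (any-false _ (allFin (q H)) none (∈.∈-allFin v))

  unsplit⇒monochrome : {N : ℕ} (f : Vec Bool N) (u : Fin (p H)) (T : List (Fin (q H))) →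
    All (λ v → adj H u v ≡ true) T →
    (any (λ v → adj H u v ∧ induced f v) (allFin (q H)) ∧ any (λ v → adj H u v ∧ not (induced f v)) (allFin (q H))) ≡ false →
    monochrome (idMask T) f ≡ true
  unsplit⇒monochrome f u T adjacent unsplit with any (λ v → adj H u v ∧ induced f v) (allFin (q H)) in red
  ... | false = trans (cong (agrees true f (idMask T) ∨_) allBlue) (BoolProp.∨-zeroʳ _)
    where
    allBlue : agrees false f (idMask T) ≡ true
    allBlue = agrees-maskOf false f (map idOf T) (AllProp.map⁺ (absent u (induced f) red T adjacent))
  ... | true  = cong (_∨ agrees false f (idMask T)) allRed
    where
    allRed : agrees true f (idMask T) ≡ true
    allRed = agrees-maskOf true f (map idOf T)
      (AllProp.map⁺ (All.map BoolProp.not-injective (absent u (not ∘ induced f) unsplit T adjacent)))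

  failures-bound : {N b : ℕ} (K : ℕ) (F : Vec (Vec Bool N) (pow2 K)) (T : Fin (p H) → List (Fin (q H))) →
    (∀ u → All (λ v → adj H u v ≡ true) (T u)) →
    (∀ u → count (monochrome (idMask (T u))) (toList F) ≤ b) →
    countTrue (λ r → not (splits H (λ v → familyColour K F r (idOf v)))) ≤ p H * b
  failures-bound {N} {b} K F T adjacent few = begin
    countTrue (λ r → not (splits H (induced (f r))))
      ≡⟨ countTrue-count _ (bitStrings K) ⟩
    count (λ r → not (splits H (induced (f r)))) (bitStrings K)
      ≤⟨ count-mono (λ r → not-all⇒any _ (bad r) (λ u → unsplit⇒monochrome (f r) u (T u) (adjacent u)) us) (bitStrings K) ⟩
    count (λ r → any (λ u → bad r u) us) (bitStrings K)
      ≤⟨ count-any us (λ u r → bad r u) (bitStrings K) ⟩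
    sumOver us (λ u → count (λ r → bad r u) (bitStrings K))
      ≡⟨ sumOver-cong us (λ u → count-select K (monochrome (idMask (T u))) F) ⟩
    sumOver us (λ u → count (monochrome (idMask (T u))) (toList F))
      ≤⟨ sumOver-mono us few ⟩
    sumOver us (λ _ → b)
      ≡⟨ sumOver-const us b ⟩
    length us * b
      ≡⟨ cong (_* b) (List.length-tabulate {n = p H} (λ u → u)) ⟩
    p H * b ∎
    where
    open ≤-Reasoning
    us : List (Fin (p H))
    us = allFin (p H)
    f : Vec Bool K → Vec Bool N
    f r = select K r F
    bad : Vec Bool K → Fin (p H) → Bool
    bad r u = monochrome (idMask (T u)) (f r)

n≤2^⌈log₂n⌉ : (n : ℕ) → n ≤ 2 ^ ⌈log₂ n ⌉
n≤2^⌈log₂n⌉ n = bound n (<-wellFounded n)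
  where
  bound : ∀ n (rec : Acc _<_ n) → n ≤ 2 ^ ⌈log2⌉ n rec
  bound zero          _        = z≤n
  bound (suc zero)    _        = s≤s z≤n
  bound (suc (suc m)) (acc rs) = begin
    2 + m                     ≤⟨ +-monoʳ-≤ 2 halves ⟩
    2 + (⌈ m /2⌉ + ⌈ m /2⌉)   ≡⟨ twice (⌈ m /2⌉) ⟩
    2 * suc ⌈ m /2⌉           ≤⟨ *-monoʳ-≤ 2 (bound (suc ⌈ m /2⌉) _) ⟩
    2 * 2 ^ ⌈log2⌉ (suc ⌈ m /2⌉) _ ∎
    where
    open ≤-Reasoning
    halves : m ≤ ⌈ m /2⌉ + ⌈ m /2⌉
    halves = ≤-trans (≤-reflexive (sym (⌊n/2⌋+⌈n/2⌉≡n m))) (+-monoˡ-≤ ⌈ m /2⌉ (⌊n/2⌋≤⌈n/2⌉ m))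
    twice : ∀ h → 2 + (h + h) ≡ 2 * suc h
    twice = solve 1 (λ h → con 2 :+ (h :+ h) := con 2 :* (con 1 :+ h)) refl

n<2^[1+⌊log₂n⌋] : (n : ℕ) → n < 2 ^ suc ⌊log₂ n ⌋
n<2^[1+⌊log₂n⌋] n = bound n (<-wellFounded n)
  where
  halves : ∀ m → m ≤ suc (⌊ m /2⌋ + ⌊ m /2⌋)
  halves zero          = z≤n
  halves (suc zero)    = s≤s z≤n
  halves (suc (suc m)) = s≤s (≤-trans (s≤s (halves m)) (≤-reflexive (cong suc (sym (+-suc _ _)))))
  bound : ∀ n (rec : Acc _<_ n) → n < 2 ^ suc (⌊log2⌋ n rec)
  bound zero          _        = s≤s z≤n
  bound (suc zero)    _        = s≤s (s≤s z≤n)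
  bound (suc (suc m)) (acc rs) = begin
    3 + m                           ≤⟨ +-monoʳ-≤ 3 (halves m) ⟩
    3 + suc (⌊ m /2⌋ + ⌊ m /2⌋)     ≤⟨ ≤-reflexive (double (⌊ m /2⌋)) ⟩
    2 * suc (suc ⌊ m /2⌋)           ≤⟨ *-monoʳ-≤ 2 (bound (suc ⌊ m /2⌋) _) ⟩
    2 * 2 ^ suc (⌊log2⌋ (suc ⌊ m /2⌋) _) ∎
    where
    open ≤-Reasoning
    double : ∀ h → 3 + suc (h + h) ≡ 2 * suc (suc h)
    double = solve 1 (λ h → con 4 :+ (h :+ h) := con 2 :* (con 2 :+ h)) refl

⌈log₂n⌉≤1+⌊log₂n⌋ : (n : ℕ) → ⌈log₂ n ⌉ ≤ suc ⌊log₂ n ⌋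
⌈log₂n⌉≤1+⌊log₂n⌋ n =
  ≤-trans (⌈log₂⌉-mono-≤ (<⇒≤ (n<2^[1+⌊log₂n⌋] n))) (≤-reflexive (⌈log₂2^n⌉≡n (suc ⌊log₂ n ⌋)))

n<2^n : (x : ℕ) → x < 2 ^ x
n<2^n zero    = s≤s z≤n
n<2^n (suc x) = begin
  suc (suc x)      ≤⟨ +-mono-≤ (m^n>0 2 x) (n<2^n x) ⟩
  2 ^ x + 2 ^ x    ≡⟨ cong (2 ^ x +_) (+-identityʳ (2 ^ x)) ⟨
  2 ^ suc x        ∎
  where open ≤-Reasoning

degree-bound : (ℓ κ D : ℕ) → 1 ≤ ℓ → κ ≤ ℓ → ℓ ^ 4 ≤ κ * D → ℓ ^ 3 ≤ D
degree-bound ℓ@(suc _) κ D _ κ≤ℓ ℓ⁴≤κD with ℓ ^ 3 ≤? D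
... | yes ℓ³≤D = ℓ³≤D
... | no  ℓ³≰D = contradiction ℓ⁴≤κD (<⇒≱ (≤-<-trans (*-monoˡ-≤ D κ≤ℓ) (*-monoʳ-< ℓ (≰⇒> ℓ³≰D))))

-- The exponent comparison behind the existence of a good family: with
-- (e+1)-sets, t = D + 2 and X random bits per unit of D, the union bound
-- 2^(D(e+1)) · 2^(X t) stays below 2^(e t) once e is large.
exponent-bound : (D X e : ℕ) → (X + 1) * (D + 2) + 2 ≤ suc e → D * suc e + X * (D + 2) < e * (D + 2)
exponent-bound D X e large = begin-strict
  D * suc e + X * (D + 2)        ≡⟨ expand D X e ⟩
  D * e + (D + X * (D + 2))      <⟨ +-monoʳ-< (D * e) below ⟩
  D * e + e                      ≤⟨ m≤m+n (D * e + e) e ⟩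
  D * e + e + e                  ≡⟨ collect D e ⟩
  e * (D + 2)                    ∎
  where
  open ≤-Reasoning
  expand : ∀ D X e → D * suc e + X * (D + 2) ≡ D * e + (D + X * (D + 2))
  expand = solve 3 (λ D X e → D :* (con 1 :+ e) :+ X :* (D :+ con 2) := D :* e :+ (D :+ X :* (D :+ con 2))) refl
  collect : ∀ D e → D * e + e + e ≡ e * (D + 2)
  collect = solve 2 (λ D e → D :* e :+ e :+ e := e :* (D :+ con 2)) refl
  unfold : ∀ D X → (X + 1) * (D + 2) + 2 ≡ 4 + (D + X * (D + 2))
  unfold = solve 2 (λ D X → (X :+ con 1) :* (D :+ con 2) :+ con 2 := con 4 :+ (D :+ X :* (D :+ con 2))) refl
  below : D + X * (D + 2) < e
  below = ≤-trans (m≤n+m _ 2) (≤-pred (≤-trans (≤-reflexive (sym (unfold D X))) large))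

-- With L ≤ ℓ + 1 and ℓ at least a constant, the size condition of
-- exponent-bound holds with room ℓ^3 for D = d L and X = C L.
size-bound : (C d ℓ L : ℕ) → L ≤ suc ℓ → (2 * C + 1) * (2 * d + 2) + 2 ≤ ℓ →
  (C * L + 1) * (d * L + 2) + 2 ≤ ℓ ^ 3
size-bound C d ℓ L L≤1+ℓ ℓ-large = begin
  (C * L + 1) * (d * L + 2) + 2                      ≤⟨ +-mono-≤ (*-mono-≤ bits depth) 2≤ℓ² ⟩
  ((2 * C + 1) * ℓ) * ((2 * d + 2) * ℓ) + ℓ * ℓ      ≡⟨ factor (2 * C + 1) (2 * d + 2) ℓ ⟩
  ((2 * C + 1) * (2 * d + 2) + 1) * (ℓ * ℓ)          ≤⟨ *-monoˡ-≤ (ℓ * ℓ) (≤-trans (+-monoʳ-≤ _ (s≤s z≤n)) ℓ-large) ⟩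
  ℓ * (ℓ * ℓ)                                        ≡⟨ cong (λ z → ℓ * (ℓ * z)) (*-identityʳ ℓ) ⟨
  ℓ ^ 3                                              ∎
  where
  open ≤-Reasoning
  2≤ℓ : 2 ≤ ℓ
  2≤ℓ = ≤-trans (m≤n+m 2 _) ℓ-large
  L≤2ℓ : L ≤ 2 * ℓ
  L≤2ℓ = ≤-trans L≤1+ℓ (≤-trans (≤-reflexive (+-comm 1 ℓ)) (+-monoʳ-≤ ℓ (≤-trans (≤-trans (s≤s z≤n) 2≤ℓ) (m≤m+n ℓ 0))))
  bits : C * L + 1 ≤ (2 * C + 1) * ℓ
  bits = begin
    C * L + 1           ≤⟨ +-mono-≤ (*-monoʳ-≤ C L≤2ℓ) (≤-trans (s≤s z≤n) 2≤ℓ) ⟩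
    C * (2 * ℓ) + ℓ     ≡⟨ solve 2 (λ C ℓ → C :* (con 2 :* ℓ) :+ ℓ := (con 2 :* C :+ con 1) :* ℓ) refl C ℓ ⟩
    (2 * C + 1) * ℓ     ∎
  depth : d * L + 2 ≤ (2 * d + 2) * ℓ
  depth = begin
    d * L + 2           ≤⟨ +-mono-≤ (*-monoʳ-≤ d L≤2ℓ) (≤-trans 2≤ℓ (m≤m+n ℓ ℓ)) ⟩
    d * (2 * ℓ) + (ℓ + ℓ) ≡⟨ solve 2 (λ d ℓ → d :* (con 2 :* ℓ) :+ (ℓ :+ ℓ) := (con 2 :* d :+ con 2) :* ℓ) refl d ℓ ⟩
    (2 * d + 2) * ℓ     ∎
  2≤ℓ² : 2 ≤ ℓ * ℓ
  2≤ℓ² = ≤-trans 2≤ℓ (m≤m*n ℓ ℓ {{>-nonZero (≤-trans (s≤s z≤n) 2≤ℓ)}})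
  factor : ∀ P Q ℓ → (P * ℓ) * (Q * ℓ) + ℓ * ℓ ≡ (P * Q + 1) * (ℓ * ℓ)
  factor = solve 3 (λ P Q ℓ → (P :* ℓ) :* (Q :* ℓ) :+ ℓ :* ℓ := (P :* Q :+ con 1) :* (ℓ :* ℓ)) refl

-- The final union bound over U: p ≤ a n nodes, each failing for at most
-- d L + 1 random strings, times n, fit into 2^((a+d+2) L).
union-bound : (a d L n p : ℕ) → 1 ≤ L → n ≤ 2 ^ L → p ≤ a * n → p * (d * L + 1) * n ≤ 2 ^ ((a + d + 2) * L)
union-bound a d L n p 1≤L n≤2^L p≤an = begin
  p * (d * L + 1) * n                           ≤⟨ *-mono-≤ (*-mono-≤ (≤-trans p≤an (*-mono-≤ a≤ n≤2^L)) dL+1≤) n≤2^L ⟩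
  2 ^ (a * L) * 2 ^ L * 2 ^ (d * L) * 2 ^ L     ≡⟨ powers ⟩
  2 ^ ((a + d + 2) * L)                         ∎
  where
  open ≤-Reasoning
  a≤ : a ≤ 2 ^ (a * L)
  a≤ = ≤-trans (<⇒≤ (n<2^n a)) (^-monoʳ-≤ 2 (≤-trans (≤-reflexive (sym (*-identityʳ a))) (*-monoʳ-≤ a 1≤L)))
  dL+1≤ : d * L + 1 ≤ 2 ^ (d * L)
  dL+1≤ = ≤-trans (≤-reflexive (+-comm (d * L) 1)) (n<2^n (d * L))
  exponents : a * L + L + d * L + L ≡ (a + d + 2) * L
  exponents = solve 3 (λ a d L → a :* L :+ L :+ d :* L :+ L := (a :+ d :+ con 2) :* L) refl a d L
  powers : 2 ^ (a * L) * 2 ^ L * 2 ^ (d * L) * 2 ^ L ≡ 2 ^ ((a + d + 2) * L)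
  powers = begin-equality
    2 ^ (a * L) * 2 ^ L * 2 ^ (d * L) * 2 ^ L    ≡⟨ cong (λ z → z * 2 ^ (d * L) * 2 ^ L) (^-distribˡ-+-* 2 (a * L) L) ⟨
    2 ^ (a * L + L) * 2 ^ (d * L) * 2 ^ L        ≡⟨ cong (_* 2 ^ L) (^-distribˡ-+-* 2 (a * L + L) (d * L)) ⟨
    2 ^ (a * L + L + d * L) * 2 ^ L              ≡⟨ ^-distribˡ-+-* 2 (a * L + L + d * L) L ⟨
    2 ^ (a * L + L + d * L + L)                  ≡⟨ cong (2 ^_) exponents ⟩
    2 ^ ((a + d + 2) * L)                        ∎

-- For constants a, d, κ let C = a + d + 2.  For the
-- parameter n, with ℓ = ⌊log₂ n⌋ and L = ⌈log₂ n⌉, the algorithm reads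
-- K = C L shared random bits and uses them to select one of 2^K colourings of
-- the identifiers < n^d, from a fixed family in which every set of ℓ^3
-- identifiers is monochromatic in at most d L + 1 members.
module Construction (a d κ : ℕ) where

  C : ℕ
  C = a + d + 2

  -- the lower bound on ℓ that makes a good family exist
  Q : ℕ
  Q = (2 * C + 1) * (2 * d + 2) + 2

  n₀ : ℕ
  n₀ = 2 ^ (Q + κ)

  ℓ L s e t N K M : ℕ → ℕ
  ℓ n = ⌊log₂ n ⌋
  L n = ⌈log₂ n ⌉
  s n = ℓ n ^ 3        -- the number of neighbours inspected per node of U
  e n = s n ∸ 1
  t n = d * L n + 2    -- the bound on monochromatic members of the family
  N n = n ^ d          -- the range of identifiers
  K n = C * L n
  M n = pow2 (K n)

  module Good (n : ℕ) = GoodFamily (N n) (M n) (e n) (t n)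

  -- the family used for the parameter n: a good one whenever the existence
  -- condition holds (which is the case for n ≥ n₀), arbitrary otherwise
  family : (n : ℕ) → Good.Family n
  family n with N n ^ suc (e n) * M n ^ t n <? (2 ^ e n) ^ t n
  ... | yes small = proj₁ (Good.good-family n small)
  ... | no  _     = replicate _ (replicate _ false)

  family-good : (n : ℕ) → N n ^ suc (e n) * M n ^ t n < (2 ^ e n) ^ t n → Good.bad n (family n) ≡ false
  family-good n small with N n ^ suc (e n) * M n ^ t n <? (2 ^ e n) ^ t n
  ... | yes small′ = proj₂ (Good.good-family n small′)
  ... | no  large  = contradiction small large

  algorithm : ZeroRoundAlg (λ n → C * ⌈log₂ n ⌉)
  algorithm n = familyColour (K n) (family n)

  module Large (n : ℕ) (n₀≤n : n₀ ≤ n) where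

    Q+κ≤ℓ : Q + κ ≤ ℓ n
    Q+κ≤ℓ = subst (_≤ ℓ n) (⌊log₂[2^n]⌋≡n (Q + κ)) (⌊log₂⌋-mono-≤ n₀≤n)

    Q≤ℓ : Q ≤ ℓ n
    Q≤ℓ = ≤-trans (m≤m+n Q κ) Q+κ≤ℓ

    κ≤ℓ : κ ≤ ℓ n
    κ≤ℓ = ≤-trans (m≤n+m κ Q) Q+κ≤ℓ

    1≤Q : 1 ≤ Q
    1≤Q = ≤-trans (s≤s z≤n) (m≤n+m 2 _)

    1≤ℓ : 1 ≤ ℓ n
    1≤ℓ = ≤-trans 1≤Q Q≤ℓ

    1≤L : 1 ≤ L n
    1≤L = subst (_≤ L n) (⌈log₂2^n⌉≡n 1)
            (⌈log₂⌉-mono-≤ (≤-trans (^-monoʳ-≤ 2 (≤-trans 1≤Q (m≤m+n Q κ))) n₀≤n))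

    1+e≡s : suc (e n) ≡ s n
    1+e≡s = suc-pred (s n) {{m^n≢0 (ℓ n) 3 {{>-nonZero 1≤ℓ}}}}

    small : N n ^ suc (e n) * M n ^ t n < (2 ^ e n) ^ t n
    small = begin-strict
      N n ^ suc (e n) * M n ^ t n
        ≤⟨ *-monoˡ-≤ (M n ^ t n) (^-monoˡ-≤ (suc (e n)) (^-monoˡ-≤ d (n≤2^⌈log₂n⌉ n))) ⟩
      ((2 ^ L n) ^ d) ^ suc (e n) * M n ^ t n
        ≡⟨ cong₂ _*_ identifiers bits ⟩
      2 ^ (d * L n * suc (e n)) * 2 ^ (K n * t n)
        ≡⟨ ^-distribˡ-+-* 2 (d * L n * suc (e n)) (K n * t n) ⟨
      2 ^ (d * L n * suc (e n) + C * L n * (d * L n + 2))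
        <⟨ ^-monoʳ-< 2 (s≤s (s≤s z≤n)) (exponent-bound (d * L n) (C * L n) (e n) sizes) ⟩
      2 ^ (e n * t n)
        ≡⟨ ^-*-assoc 2 (e n) (t n) ⟨
      (2 ^ e n) ^ t n ∎
      where
      open ≤-Reasoning
      identifiers : ((2 ^ L n) ^ d) ^ suc (e n) ≡ 2 ^ (d * L n * suc (e n))
      identifiers = begin-equality
        ((2 ^ L n) ^ d) ^ suc (e n)  ≡⟨ cong (_^ suc (e n)) (^-*-assoc 2 (L n) d) ⟩
        (2 ^ (L n * d)) ^ suc (e n)  ≡⟨ ^-*-assoc 2 (L n * d) (suc (e n)) ⟩
        2 ^ (L n * d * suc (e n))    ≡⟨ cong (λ x → 2 ^ (x * suc (e n))) (*-comm (L n) d) ⟩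
        2 ^ (d * L n * suc (e n))    ∎
      bits : M n ^ t n ≡ 2 ^ (K n * t n)
      bits = trans (cong (_^ t n) (pow2≡2^ (K n))) (^-*-assoc 2 (K n) (t n))
      sizes : (C * L n + 1) * (d * L n + 2) + 2 ≤ suc (e n)
      sizes = subst ((C * L n + 1) * (d * L n + 2) + 2 ≤_) (sym 1+e≡s) (size-bound C d (ℓ n) (L n) (⌈log₂n⌉≤1+⌊log₂n⌋ n) Q≤ℓ)

    module OnGraph (H : Bipartite) (ids : IdAssignment H (n ^ d))
                   (dense : (u : Fin (p H)) → ⌊log₂ n ⌋ ^ 4 ≤ κ * degree H u) where

      open ZeroRound H ids

      neighbours : Fin (p H) → List (Fin (q H))
      neighbours u = filter (λ v → adj H u v Bool.≟ true) (allFin (q H))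

      inspected : Fin (p H) → List (Fin (q H))
      inspected u = take (s n) (neighbours u)

      adjacent : ∀ u → All (λ v → adj H u v ≡ true) (inspected u)
      adjacent u = AllProp.take⁺ (s n) (AllProp.all-filter (λ v → adj H u v Bool.≟ true) (allFin (q H)))

      enough : ∀ u → length (map idOf (inspected u)) ≡ suc (e n)
      enough u = begin-equality
        length (map idOf (inspected u))        ≡⟨ List.length-map idOf (inspected u) ⟩
        length (take (s n) (neighbours u))     ≡⟨ List.length-take (s n) (neighbours u) ⟩
        s n ⊓ degree H u                       ≡⟨ m≤n⇒m⊓n≡m (degree-bound (ℓ n) κ (degree H u) 1≤ℓ κ≤ℓ (dense u)) ⟩
        s n                                    ≡⟨ 1+e≡s ⟨
        suc (e n)                              ∎
        where open ≤-Reasoning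

      distinct : ∀ u → Unique (map idOf (inspected u))
      distinct u = Unique.map⁺ (inj₂-injective ∘ injective ids)
        (Unique.take⁺ (s n) (Unique.filter⁺ (λ v → adj H u v Bool.≟ true) (Unique.allFin⁺ (q H))))

      inRange : ∀ u → All (_< N n) (map idOf (inspected u))
      inRange u = AllProp.map⁺ (All.universal (λ v → bounded ids (inj₂ v)) (inspected u))

      rarelyMonochrome : ∀ u → count (monochrome (idMask (inspected u))) (toList (family n)) ≤ d * L n + 1
      rarelyMonochrome u = ≤-pred (subst (count (monochrome (idMask (inspected u))) (toList (family n)) <_) (+-suc (d * L n) 1)
        (Good.good-family-sound n (family n) (family-good n small) _ (enough u) (distinct u) (inRange u)))

      failures : countTrue (λ r → not (splits H (runAlg algorithm n H ids r))) ≤ p H * (d * L n + 1)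
      failures = failures-bound (K n) (family n) inspected adjacent rarelyMonochrome

lemma3p4 : (a d κ : ℕ) →
    ∃ λ (c : ℕ) → ∃ λ (C : ℕ) →
    Σ (ZeroRoundAlg (λ n → C * ⌈log₂ n ⌉)) λ A →
    ∃ λ (n₀ : ℕ) →
    (n : ℕ) → n₀ ≤ n →
    (H : Bipartite) → p H + q H ≤ a * n →
    (ids : IdAssignment H (n ^ d)) →
    ((u : Fin (p H)) → ⌊log₂ n ⌋ ^ c ≤ κ * degree H u) →
    countTrue (λ r → not (splits H (runAlg A n H ids r))) * n ≤ 2 ^ (C * ⌈log₂ n ⌉)
lemma3p4 a d κ = 4 , C , algorithm , n₀ , λ n n₀≤n H size ids dense →
  let open Large n n₀≤n
      open OnGraph H ids dense
  in ≤-trans (*-monoˡ-≤ n failures)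
             (union-bound a d (L n) n (p H) 1≤L (n≤2^⌈log₂n⌉ n) (≤-trans (m≤m+n (p H) (q H)) size))
  where open Construction a d κ
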